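{- Let $X$ be a finite set and $\Delta$ a nonempty abstract simplicial complex of $X$. Then $\Delta$ can be represented as the clique complex of a graph (equivalently, as the independence complex of a graph), i.e. there is a graph $H$ with $V(H)\subseteq X$ whose family of cliques (including $\emptyset$) is exactly $\Delta$, if and only if $\Delta$ satisfies the Median Property: for any $D_1,D_2,D_3\in\Delta$, $(D_1\cap D_2)\cup(D_1\cap D_3)\cup(D_2\cap D_3)\in\Delta$.
   Context: An abstract simplicial complex (ASC) of a set $X$ is a family $\Delta$ of subsets of $X$ such that $S\in\Delta$ and $S'\subseteq S$ imply $S'\in\Delta$. The clique complex of a graph $H$ is the family of all cliques of $H$ (sets of pairwise adjacent vertices, including the empty set); the independence complex is the family of all independent sets. The clique complex of $H$ equals the independence complex of the complement of $H$. -}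

module Defs where

open import Level using (0ℓ)
open import Data.Nat using (ℕ)
open import Data.Fin using (Fin)
open import Data.Fin.Subset using (Subset; _∈_; _⊆_; _∩_; _∪_)
open import Data.Product using (Σ; _×_)
open import Relation.Nullary using (¬_)
open import Relation.Binary.PropositionalEquality using (_≡_)
open import Function.Bundles using (_⇔_)

-- The ground set X is Fin n; a family of subsets of X is a predicate on Subset n.
Family : ℕ → Set₁
Family n = Subset n → Set

IsASC : ∀ {n} → Family n → Set
IsASC {n} Δ = ∀ (S S′ : Subset n) → Δ S → S′ ⊆ S → Δ S′

NonemptyFamily : ∀ {n} → Family n → Set
NonemptyFamily {n} Δ = Σ (Subset n) Δ

record Graph (n : ℕ) : Set₁ where
  field
    V      : Fin n → Set
    Adj    : Fin n → Fin n → Set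
    sym    : ∀ {i j} → Adj i j → Adj j i
    irrefl : ∀ {i} → ¬ Adj i i
    adj⊆V  : ∀ {i j} → Adj i j → V i × V j

IsClique : ∀ {n} → Graph n → Subset n → Set
IsClique H S =
  (∀ {i} → i ∈ S → Graph.V H i) ×
  (∀ {i j} → i ∈ S → j ∈ S → ¬ i ≡ j → Graph.Adj H i j)

IsCliqueComplexOf : ∀ {n} → Family n → Graph n → Set
IsCliqueComplexOf {n} Δ H = ∀ (S : Subset n) → Δ S ⇔ IsClique H S

MedianProperty : ∀ {n} → Family n → Set
MedianProperty {n} Δ = ∀ (D₁ D₂ D₃ : Subset n) → Δ D₁ → Δ D₂ → Δ D₃ →
  Δ ((D₁ ∩ D₂) ∪ (D₁ ∩ D₃) ∪ (D₂ ∩ D₃))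

-- A clique complex has the median property because cliques are defined by a
-- condition on pairs of vertices, and any two elements of the median of D₁, D₂, D₃
-- lie in a common Dₖ (each lies in two of the three). Conversely, take H to be the
-- 1-skeleton of Δ; every simplex is a clique of it, and a clique S of H is in Δ by
-- induction on S: the empty set and the singletons are in Δ, and if a ≢ b are in S
-- then S is contained in the median of S - a, S - b and the edge {a, b}.
module Submission where

open import Defs
open import Data.Nat using (ℕ)
open import Data.Fin using (Fin; _≟_)
open import Data.Fin.Subset
open import Data.Fin.Subset.Properties
open import Data.Fin.Subset.Induction using (⊂-wellFounded)
open import Data.Vec using (_∷_; here; there)
open import Data.Product using (Σ; _×_; _,_; proj₁; proj₂)
open import Data.Sum using (_⊎_; inj₁; inj₂; [_,_])
import Data.Sum as Sum
open import Function using (_∘_)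
open import Function.Bundles using (_⇔_; mk⇔; Equivalence)
open import Induction.WellFounded using (Acc; acc)
open import Relation.Nullary using (yes; no; contradiction)
open import Relation.Binary.PropositionalEquality using (_≢_; refl; sym; subst)

private
  variable
    n : ℕ

median : Subset n → Subset n → Subset n → Subset n
median D₁ D₂ D₃ = (D₁ ∩ D₂) ∪ (D₁ ∩ D₃) ∪ (D₂ ∩ D₃)

x∈p─q⇒x∉q : ∀ {p q : Subset n} {x} → x ∈ p ─ q → x ∉ q
x∈p─q⇒x∉q {p = inside ∷ _}  {outside ∷ _} here        ()
x∈p─q⇒x∉q {p = _ ∷ _}       {_ ∷ _}       (there x∈) (there x∈q) = x∈p─q⇒x∉q x∈ x∈q

x∈p-y⇒x≢y : ∀ {p : Subset n} {x y} → x ∈ p - y → x ≢ y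
x∈p-y⇒x≢y {y = y} x∈ refl = x∈p─q⇒x∉q x∈ (x∈⁅x⁆ y)

x∈p⇒⁅x⁆⊆p : ∀ {p : Subset n} {x} → x ∈ p → ⁅ x ⁆ ⊆ p
x∈p⇒⁅x⁆⊆p {x = x} x∈p y∈ with x∈⁅y⁆⇒x≡y x y∈
... | refl = x∈p

x,y∈p⇒⁅x⁆∪⁅y⁆⊆p : ∀ {p : Subset n} {x y} → x ∈ p → y ∈ p → ⁅ x ⁆ ∪ ⁅ y ⁆ ⊆ p
x,y∈p⇒⁅x⁆∪⁅y⁆⊆p x∈p y∈p = [ x∈p⇒⁅x⁆⊆p x∈p , x∈p⇒⁅x⁆⊆p y∈p ] ∘ x∈p∪q⁻ _ _

data Shape (S : Subset n) : Set where
  empty     : Empty S → Shape S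
  singleton : ∀ {a} → a ∈ S → S ⊆ ⁅ a ⁆ → Shape S
  two       : ∀ {a b} → a ∈ S → b ∈ S → a ≢ b → Shape S

shape : (S : Subset n) → Shape S
shape S with nonempty? S
... | no ∄x = empty ∄x
... | yes (a , a∈S) with nonempty? (S - a)
...   | yes (b , b∈S-a) = two a∈S (p─q⊆p S ⁅ a ⁆ b∈S-a) (x∈p-y⇒x≢y b∈S-a ∘ sym)
...   | no ∄x = singleton a∈S S⊆⁅a⁆
  where
  S⊆⁅a⁆ : S ⊆ ⁅ a ⁆
  S⊆⁅a⁆ {x} x∈S with x ≟ a
  ... | yes refl = x∈⁅x⁆ a
  ... | no x≢a = contradiction (x , x∈p∧x≢y⇒x∈p-y x∈S x≢a) ∄x

∈-median⁻ : ∀ (D₁ D₂ D₃ : Subset n) {x} → x ∈ median D₁ D₂ D₃ →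
            (x ∈ D₁ × x ∈ D₂) ⊎ (x ∈ D₁ × x ∈ D₃) ⊎ (x ∈ D₂ × x ∈ D₃)
∈-median⁻ D₁ D₂ D₃ =
  Sum.map (x∈p∩q⁻ D₁ D₂) (Sum.map (x∈p∩q⁻ D₁ D₃) (x∈p∩q⁻ D₂ D₃) ∘ x∈p∪q⁻ _ _)
  ∘ x∈p∪q⁻ _ _

Both : Subset n → Fin n → Fin n → Set
Both D x y = x ∈ D × y ∈ D

median-pair-shares-component : ∀ (D₁ D₂ D₃ : Subset n) {x y} →
  x ∈ median D₁ D₂ D₃ → y ∈ median D₁ D₂ D₃ →
  Both D₁ x y ⊎ Both D₂ x y ⊎ Both D₃ x y
median-pair-shares-component D₁ D₂ D₃ x∈ y∈
  with ∈-median⁻ D₁ D₂ D₃ x∈ | ∈-median⁻ D₁ D₂ D₃ y∈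
... | inj₁ (x₁ , _)        | inj₁ (y₁ , _)        = inj₁ (x₁ , y₁)
... | inj₁ (x₁ , _)        | inj₂ (inj₁ (y₁ , _)) = inj₁ (x₁ , y₁)
... | inj₁ (_ , x₂)        | inj₂ (inj₂ (y₂ , _)) = inj₂ (inj₁ (x₂ , y₂))
... | inj₂ (inj₁ (x₁ , _)) | inj₁ (y₁ , _)        = inj₁ (x₁ , y₁)
... | inj₂ (inj₁ (x₁ , _)) | inj₂ (inj₁ (y₁ , _)) = inj₁ (x₁ , y₁)
... | inj₂ (inj₁ (_ , x₃)) | inj₂ (inj₂ (_ , y₃)) = inj₂ (inj₂ (x₃ , y₃))
... | inj₂ (inj₂ (x₂ , _)) | inj₁ (_ , y₂)        = inj₂ (inj₁ (x₂ , y₂))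
... | inj₂ (inj₂ (_ , x₃)) | inj₂ (inj₁ (_ , y₃)) = inj₂ (inj₂ (x₃ , y₃))
... | inj₂ (inj₂ (x₂ , _)) | inj₂ (inj₂ (y₂ , _)) = inj₂ (inj₁ (x₂ , y₂))

⊆-median-deletions-edge : ∀ (S : Subset n) {a b} → a ≢ b →
                          S ⊆ median (S - a) (S - b) (⁅ a ⁆ ∪ ⁅ b ⁆)
⊆-median-deletions-edge S {a} {b} a≢b {x} x∈S with x ≟ a | x ≟ b
... | yes refl | _ = x∈p∪q⁺ (inj₂ (x∈p∪q⁺ (inj₂ (x∈p∩q⁺
      (x∈p∧x≢y⇒x∈p-y x∈S a≢b , x∈p∪q⁺ (inj₁ (x∈⁅x⁆ a)))))))
... | no x≢a | yes refl = x∈p∪q⁺ (inj₂ (x∈p∪q⁺ (inj₁ (x∈p∩q⁺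
      (x∈p∧x≢y⇒x∈p-y x∈S x≢a , x∈p∪q⁺ (inj₂ (x∈⁅x⁆ b)))))))
... | no x≢a | no x≢b = x∈p∪q⁺ (inj₁ (x∈p∩q⁺
      (x∈p∧x≢y⇒x∈p-y x∈S x≢a , x∈p∧x≢y⇒x∈p-y x∈S x≢b)))

module _ (H : Graph n) where
  open Graph H

  IsClique-⊆ : ∀ {S T} → T ⊆ S → IsClique H S → IsClique H T
  IsClique-⊆ T⊆S (vs , es) = vs ∘ T⊆S , λ i∈ j∈ → es (T⊆S i∈) (T⊆S j∈)

  IsClique-pair : ∀ {D x y} → IsClique H D → Both D x y → V x × (x ≢ y → Adj x y)
  IsClique-pair (vs , es) (x∈ , y∈) = vs x∈ , es x∈ y∈

  IsClique-median : MedianProperty (IsClique H)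
  IsClique-median D₁ D₂ D₃ c₁ c₂ c₃ =
    (λ x∈ → proj₁ (common x∈ x∈)) , (λ x∈ y∈ → proj₂ (common x∈ y∈))
    where
    common : ∀ {x y} → x ∈ median D₁ D₂ D₃ → y ∈ median D₁ D₂ D₃ → V x × (x ≢ y → Adj x y)
    common x∈ y∈ =
      [ IsClique-pair c₁ , [ IsClique-pair c₂ , IsClique-pair c₃ ] ]
        (median-pair-shares-component D₁ D₂ D₃ x∈ y∈)

MedianProperty-resp-⇔ : ∀ {Δ Δ′ : Family n} → (∀ S → Δ S ⇔ Δ′ S) →
                        MedianProperty Δ′ → MedianProperty Δ
MedianProperty-resp-⇔ Δ⇔Δ′ mp D₁ D₂ D₃ d₁ d₂ d₃ =
  from (Δ⇔Δ′ _) (mp D₁ D₂ D₃ (to (Δ⇔Δ′ D₁) d₁) (to (Δ⇔Δ′ D₂) d₂) (to (Δ⇔Δ′ D₃) d₃))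
  where open Equivalence

module _ {Δ : Family n} (asc : IsASC Δ) where
  skeleton : Graph n
  skeleton = record
    { V      = λ i → Δ ⁅ i ⁆
    ; Adj    = λ i j → i ≢ j × Δ (⁅ i ⁆ ∪ ⁅ j ⁆)
    ; sym    = λ {i} {j} (i≢j , d) → i≢j ∘ sym , subst Δ (∪-comm ⁅ i ⁆ ⁅ j ⁆) d
    ; irrefl = λ (i≢i , _) → i≢i refl
    ; adj⊆V  = λ {i} {j} (_ , d) → asc _ _ d (p⊆p∪q ⁅ j ⁆) , asc _ _ d (q⊆p∪q ⁅ i ⁆ ⁅ j ⁆)
    }

  simplex⇒clique : ∀ {S} → Δ S → IsClique skeleton S
  simplex⇒clique d =
    (λ i∈ → asc _ _ d (x∈p⇒⁅x⁆⊆p i∈)) ,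
    (λ i∈ j∈ i≢j → i≢j , asc _ _ d (x,y∈p⇒⁅x⁆∪⁅y⁆⊆p i∈ j∈))

  module _ (Δ⊥ : Δ ⊥) (mp : MedianProperty Δ) where

    clique⇒simplex : ∀ S → Acc _⊂_ S → IsClique skeleton S → Δ S
    clique⇒simplex S _ c with shape S
    ... | empty ∄x = subst Δ (sym (Empty-unique ∄x)) Δ⊥
    ... | singleton a∈S S⊆⁅a⁆ = asc _ S (proj₁ c a∈S) S⊆⁅a⁆
    clique⇒simplex S (acc rec) c | two {a} {b} a∈S b∈S a≢b =
      asc _ S (mp (S - a) (S - b) (⁅ a ⁆ ∪ ⁅ b ⁆) (delete a∈S) (delete b∈S) edge)
          (⊆-median-deletions-edge S a≢b)
      where
      delete : ∀ {x} → x ∈ S → Δ (S - x)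
      delete {x} x∈S = clique⇒simplex (S - x) (rec (x∈p⇒p-x⊂p x∈S))
                         (IsClique-⊆ skeleton (p─q⊆p S ⁅ x ⁆) c)
      edge : Δ (⁅ a ⁆ ∪ ⁅ b ⁆)
      edge = proj₂ (proj₂ c a∈S b∈S a≢b)

    clique-complex-of-skeleton : IsCliqueComplexOf Δ skeleton
    clique-complex-of-skeleton S =
      mk⇔ simplex⇒clique (clique⇒simplex S (⊂-wellFounded S))

theorem2 : (n : ℕ) (Δ : Family n) → IsASC Δ → NonemptyFamily Δ →
    (Σ (Graph n) (λ H → IsCliqueComplexOf Δ H)) ⇔ MedianProperty Δ
theorem2 n Δ asc (S , d) = mk⇔
  (λ (H , cc) → MedianProperty-resp-⇔ cc (IsClique-median H))
  (λ mp → skeleton asc , clique-complex-of-skeleton asc Δ⊥ mp)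
  where
  Δ⊥ : Δ ⊥
  Δ⊥ = asc S ⊥ d ⊥⊆
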